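{- Let $n$ be a power of two. For the online convolution problem there exists a hard distribution, with a fixed array $F\in[q]^n$ and the update array $U$ chosen uniformly at random from $[q]^n$, such that for any deterministic cell-probe algorithm solving the problem every node $v$ of the information transfer tree $\mathcal{T}$ has large information transfer, i.e. $\mathbb{E}[I_v]\ge \frac{k\cdot\delta\cdot\ell_v}{w}$ for a constant $k>0$ depending only on the problem and input distribution.
   Context: Framework: $[q]=\{0,\dots,q-1\}$, $\delta=\lfloor\log_2 q\rfloor$; cell-probe model with $w$-bit cells (a cell can store the address of any cell), cost = number of cell reads/writes. A stream $S\in[q]^n$ starts as all zeros; at arrival $t\in[n]$, $U[t]$ is appended to the right end of $S$ and the leftmost entry removed, and the algorithm outputs $A[t]=\sum_{i\in[n]}F[i]S[i]\bmod q$ before the next arrival. Information transfer tree $\mathcal{T}$: a balanced binary tree with $n$ leaves representing arrivals $0,\dots,n-1$ from left to right. For a node $v$, $\ell_v$ is the number of leaves below $v$, $t_0$ its leftmost leaf, $t_1=t_0+\ell_v/2-1$, $t_2=t_0+\ell_v-1$. The information transfer $\mathcal{I}_v$ is the set of memory cells that are probed during the processing of arrivals $t_0,\dots,t_1$ and also probed during the processing of arrivals $t_1+1,\dots,t_2$; $I_v=|\mathcal{I}_v|$. The expectation is over the random $U$. -}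

module Defs where

open import Data.Nat using (ℕ; zero; suc; _+_; _*_; _∸_; _^_; _≤_; _<_; _<?_; _≤?_; NonZero)
open import Data.Nat.DivMod using (_%_)
open import Data.Fin using (Fin; toℕ; fromℕ<)
open import Data.Fin.Properties using () renaming (_≟_ to _≟ᶠ_)
open import Data.List using (List; []; _∷_; [_]; _++_; map; concatMap; upTo; allFin; filter; length)
open import Data.Nat.ListAction using (sum)
open import Data.Product using (_×_; _,_; proj₁; proj₂)
open import Data.Bool using (if_then_else_)
open import Relation.Nullary using (yes; no; does)
open import Relation.Nullary.Decidable using (_×-dec_)
import Data.List.Membership.DecPropositional as DecMem
import Data.Vec.Functional as VF

-- Cell-probe model with w-bit cells: addresses and contents are both w-bit
-- words, so the memory is a function Fin (2^w) → Fin (2^w).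
Word : ℕ → Set
Word w = Fin (2 ^ w)

Mem : ℕ → Set
Mem w = Word w → Word w

-- The (adaptive, deterministic) probe program executed for one arrival.
data Tree (w q : ℕ) : Set where
  done  : Fin q → Tree w q
  read  : Word w → (Word w → Tree w q) → Tree w q
  write : Word w → Word w → Tree w q → Tree w q

update : ∀ {w} → Mem w → Word w → Word w → Mem w
update {w} m a c b = if does (_≟ᶠ_ {n = 2 ^ w} b a) then c else m b

run : ∀ {w q} → Tree w q → Mem w → Mem w × List (Word w) × Fin q
run (done x) m = m , [] , x
run (read a k) m with run (k (m a)) m
... | m' , ps , x = m' , a ∷ ps , x
run {w} (write a c k) m with run k (update {w} m a c)
... | m' , ps , x = m' , a ∷ ps , x

record Alg (n q w : ℕ) : Set where
  field
    init : Mem w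
    step : Fin n → Fin q → Tree w q
open Alg public

module _ {n q w : ℕ} (A : Alg n q w) (U : Fin n → Fin q) where

  -- memory before arrival t (i.e. after processing arrivals 0..t-1)
  memAt : ℕ → Mem w
  memAt zero = init A
  memAt (suc t) with t <? n
  ... | yes p = proj₁ (run (step A (fromℕ< p) (U (fromℕ< p))) (memAt t))
  ... | no _  = memAt t

  runAt : Fin n → Mem w × List (Word w) × Fin q
  runAt t = run (step A t (U t)) (memAt (toℕ t))

  outputAt : Fin n → Fin q
  outputAt t = proj₂ (proj₂ (runAt t))

  probesAt : ℕ → List (Word w)
  probesAt t with t <? n
  ... | yes p = proj₁ (proj₂ (runAt (fromℕ< p)))
  ... | no _  = []

  probesIn : ℕ → ℕ → List (Word w)
  probesIn a len = concatMap (λ i → probesAt (a + i)) (upTo len)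

-- U[k] as a natural number (0 outside the range, never used there)
uval : ∀ {n q} → (Fin n → Fin q) → ℕ → ℕ
uval {n} U k with k <? n
... | yes p = toℕ (U (fromℕ< p))
... | no _  = 0

-- Stream contents after arrival t: S[i] = U[t-(n-1-i)] if that index is ≥ 0,
-- and 0 otherwise (initial zeros).
streamAt : ∀ {n q} → (Fin n → Fin q) → ℕ → Fin n → ℕ
streamAt {n} U t i with n ≤? t + toℕ i + 1
... | yes _ = uval U ((t + toℕ i + 1) ∸ n)
... | no _  = 0

convAt : ∀ {n q} .{{_ : NonZero q}} → (Fin n → Fin q) → (Fin n → Fin q) → ℕ → ℕ
convAt {n} {q} F U t = sum (map (λ i → toℕ (F i) * streamAt U t i) (allFin n)) % q

Solves : ∀ {n q w} .{{_ : NonZero q}} → (Fin n → Fin q) → Alg n q w → Set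
Solves {n} F A = ∀ (U : Fin n → _) (t : Fin n) → toℕ (outputAt A U t) ≡ convAt F U (toℕ t)
  where open import Relation.Binary.PropositionalEquality using (_≡_)

-- Size of the intersection of two lists of cells, counting distinct cells.
interSize : ∀ {w} → List (Word w) → List (Word w) → ℕ
interSize {w} L R = length (filter {A = Word w} (λ a → (a ∈? L) ×-dec (a ∈? R)) (allFin (2 ^ w)))
  where open DecMem (_≟ᶠ_ {n = 2 ^ w}) using (_∈?_)

-- Information transfer I_v of the node of T at height d ≥ 1 (so ℓ_v = 2^d)
-- with index j among nodes of that height: t0 = j·2^d, t1 = t0 + 2^(d-1) - 1,
-- t2 = t0 + 2^d - 1.  Here d = suc e, so ℓ_v/2 = 2^e.
infoTransfer : ∀ {n q w} → Alg n q w → (Fin n → Fin q) → (e j : ℕ) → ℕ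
infoTransfer {w = w} A U e j =
  interSize {w} (probesIn A U t0 (2 ^ e)) (probesIn A U (t0 + 2 ^ e) (2 ^ e))
  where t0 = j * 2 ^ suc e

-- All arrays U ∈ [q]^n (each exactly once): the uniform distribution.
allArrays : (n q : ℕ) → List (Fin n → Fin q)
allArrays zero q = VF.[] ∷ []
allArrays (suc n) q = concatMap (λ x → map (λ f → x VF.∷ f) (allArrays n q)) (allFin q)

-- Σ_U I_v(U); the expectation is this divided by q^n.
sumInfoTransfer : ∀ {n q w} → Alg n q w → (e j : ℕ) → ℕ
sumInfoTransfer {n} {q} A e j = sum (map (λ U → infoTransfer A U e j) (allArrays n q))

-- Fix a node v with left half [t₀, t₀ + h) and right half [t₀ + h, t₀ + 2h), h = 2^e.  Every cell
-- probed in the right half is either in the information transfer or untouched since t₀, so the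
-- outputs of the right half are determined by U outside [t₀, t₀ + h) together with the addresses
-- and contents of the transferred cells.  With F equal to 1 exactly at the power-of-two lags, the
-- output at t₀ + h + r is U[t₀ + r] plus terms that read U outside [t₀, t₀ + r]; hence these
-- outputs reveal U[t₀ + h - 1], …, U[t₀] in turn, and U is determined by its encoding.  Inputs
-- with at most s = ⌊δh / 4w⌋ transferred cells have at most q^(n-h) (1 + 2^(2w))^s ≤ q^n / 2
-- encodings, so at least half of all inputs have I_v > s, and E[I_v] ≥ δh / 8w = δ ℓ_v / 16w.

module Submission where

open import Defs

open import Data.Fin using (Fin; zero; suc; toℕ; fromℕ<)
open import Data.Fin.Properties using (any?; toℕ-fromℕ<; fromℕ<-toℕ; toℕ-injective; toℕ<n) renaming (_≟_ to _≟ᶠ_)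
import Data.Fin.Properties as Fin
open import Data.List using (List; []; _∷_; _++_; map; filter; length; tabulate; allFin; upTo; applyUpTo; concatMap; cartesianProduct; cartesianProductWith)
open import Data.List.Properties using (∷-injectiveˡ; ∷-injectiveʳ; length-map; length-++; length-tabulate; length-upTo; length-applyUpTo; length-removeAt′; filter-accept; filter-reject; tabulate-cong; map-tabulate)
open import Data.List.Membership.Propositional using (_∈_; _∉_; _─_)
open import Data.List.Membership.Propositional.Properties using (∈-map⁻; ∈-++⁺ˡ; ∈-++⁺ʳ; ∈-upTo⁺; ∈-applyUpTo⁺; ∈-concatMap⁺; ∈-filter⁺; ∈-filter⁻; ∈-allFin; ∈-cartesianProduct⁺; ∈-cartesianProductWith⁺)
import Data.List.Membership.DecPropositional as DecMembership
open import Data.List.Relation.Binary.Subset.Propositional using (_⊆_)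
open import Data.List.Relation.Unary.All using (All; []; _∷_)
import Data.List.Relation.Unary.All as All
import Data.List.Relation.Unary.All.Properties as All
open import Data.List.Relation.Unary.AllPairs using ([]; _∷_)
open import Data.List.Relation.Unary.Any using (here; there)
import Data.List.Relation.Unary.Any as Any
open import Data.List.Relation.Unary.Unique.Propositional using (Unique)
open import Data.List.Relation.Unary.Unique.Propositional.Properties using (allFin⁺)
import Data.List.Relation.Unary.Unique.Setoid as UniqueSetoid
import Data.List.Relation.Unary.Unique.Setoid.Properties as UniqueS
open import Data.Maybe using (Maybe; just; nothing; fromMaybe)
open import Data.Nat hiding (_/_)
open import Data.Nat.Properties
open import Algebra.Properties.CommutativeSemigroup +-commutativeSemigroup using (xy∙z≈xz∙y; xy∙z≈y∙xz)
open import Data.Nat.DivMod using (_%_; m≡m%n+[m/n]*n; m%n<n; m/n*n≤m)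
open import Data.Nat.Divisibility using (_∣_; >⇒∤; ∣m+n∣m⇒∣n; n∣m*n)
open import Data.Nat.Induction using (<-wellFounded)
open import Data.Nat.ListAction using (sum)
open import Data.Nat.Logarithm using (⌊log₂_⌋; ⌊log₂⌋-mono-≤)
open import Data.Nat.Logarithm.Core using (⌊log2⌋)
open import Data.Nat.Tactic.RingSolver using (solve-∀)
open import Data.Product using (Σ; _×_; _,_; proj₁; proj₂)
open import Data.Sum using (_⊎_; inj₁; inj₂)
import Data.Sum as Sum
import Data.Vec.Functional as VF
open import Function using (_∘_; id)
open import Induction.WellFounded using (Acc; acc)
open import Relation.Binary.Definitions using (tri<; tri≈; tri>)
open import Relation.Binary.PropositionalEquality
open import Relation.Nullary using (Dec; yes; no; contradiction)
open import Relation.Nullary.Decidable using (_×-dec_)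

-- Probe programs and their executions

module Memory (w : ℕ) where

  open DecMembership (_≟ᶠ_ {n = 2 ^ w}) using (_∈?_)

  AgreeOn : List (Word w) → Mem w → Mem w → Set
  AgreeOn S X Y = ∀ {a} → a ∈ S → X a ≡ Y a

  update-other : (X : Mem w) {a b : Word w} (c : Word w) → b ≢ a → update {w} X a c b ≡ X b
  update-other X {a} {b} c b≢a with _≟ᶠ_ {n = 2 ^ w} b a
  ... | yes b≡a = contradiction b≡a b≢a
  ... | no _    = refl

  update-cong : (X Y : Mem w) {a b : Word w} (c : Word w) → (b ≢ a → X b ≡ Y b) →
                update {w} X a c b ≡ update {w} Y a c b
  update-cong X Y {a} {b} c agree with _≟ᶠ_ {n = 2 ^ w} b a
  ... | yes _   = refl
  ... | no b≢a  = agree b≢a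

  lookupCell : List (Word w × Word w) → Word w → Maybe (Word w)
  lookupCell []             a = nothing
  lookupCell ((b , c) ∷ E) a with _≟ᶠ_ {n = 2 ^ w} a b
  ... | yes _ = just c
  ... | no _  = lookupCell E a

  overlay : Mem w → List (Word w × Word w) → Mem w
  overlay X E a = fromMaybe (X a) (lookupCell E a)

  overlay-∈ : (X g : Mem w) {S : List (Word w)} {a : Word w} → a ∈ S → overlay X (map (λ b → b , g b) S) a ≡ g a
  overlay-∈ X g {b ∷ S} {a} a∈ with _≟ᶠ_ {n = 2 ^ w} a b
  overlay-∈ X g {b ∷ S} a∈         | yes refl = refl
  overlay-∈ X g {b ∷ S} (here a≡b)  | no a≢b  = contradiction a≡b a≢b
  overlay-∈ X g {b ∷ S} (there a∈) | no _    = overlay-∈ X g a∈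

  overlay-∉ : (X g : Mem w) {S : List (Word w)} {a : Word w} → a ∉ S → overlay X (map (λ b → b , g b) S) a ≡ X a
  overlay-∉ X g {[]}    a∉ = refl
  overlay-∉ X g {b ∷ S} {a} a∉ with _≟ᶠ_ {n = 2 ^ w} a b
  ... | yes a≡b = contradiction (here a≡b) a∉
  ... | no _    = overlay-∉ X g (a∉ ∘ there)

  shared : List (Word w) → List (Word w) → List (Word w)
  shared L R = filter (λ a → (a ∈? L) ×-dec (a ∈? R)) (allFin (2 ^ w))

  shared-⊆ˡ : ∀ {L R a} → a ∈ shared L R → a ∈ L
  shared-⊆ˡ {L} {R} = proj₁ ∘ proj₂ ∘ ∈-filter⁻ (λ a → (a ∈? L) ×-dec (a ∈? R)) {xs = allFin (2 ^ w)}

  ∈-shared : ∀ {L R a} → a ∈ L → a ∈ R → a ∈ shared L R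
  ∈-shared {L} {R} {a} a∈L a∈R = ∈-filter⁺ (λ a → (a ∈? L) ×-dec (a ∈? R)) (∈-allFin a) (a∈L , a∈R)

module _ {w q : ℕ} where

  open Memory w

  memAfter : Tree w q → Mem w → Mem w
  memAfter p X = proj₁ (run p X)

  probed : Tree w q → Mem w → List (Word w)
  probed p X = proj₁ (proj₂ (run p X))

  result : Tree w q → Mem w → Fin q
  result p X = proj₂ (proj₂ (run p X))

  memAfter-unprobed : (p : Tree w q) (X : Mem w) {a : Word w} → a ∉ probed p X → memAfter p X a ≡ X a
  memAfter-unprobed (done _)      X a∉ = refl
  memAfter-unprobed (read b k)    X a∉ = memAfter-unprobed (k (X b)) X (a∉ ∘ there)
  memAfter-unprobed (write b c k) X a∉ =
    trans (memAfter-unprobed k (update {w} X b c) (a∉ ∘ there)) (update-other X c (a∉ ∘ here))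

  private
    agreeOn-update : (X Y : Mem w) (b c : Word w) {S : List (Word w)} →
                     AgreeOn (b ∷ S) X Y → AgreeOn S (update {w} X b c) (update {w} Y b c)
    agreeOn-update X Y b c agree a∈S = update-cong X Y c (λ _ → agree (there a∈S))

  result-local : (p : Tree w q) (X Y : Mem w) → AgreeOn (probed p X) X Y → result p Y ≡ result p X
  result-local (done _)      X Y agree = refl
  result-local (read b k)    X Y agree rewrite sym (agree (here refl)) =
    result-local (k (X b)) X Y (agree ∘ there)
  result-local (write b c k) X Y agree =
    result-local k (update {w} X b c) (update {w} Y b c) (agreeOn-update X Y b c agree)

  memAfter-local : (p : Tree w q) (X Y : Mem w) → AgreeOn (probed p X) X Y →
                   ∀ {a} → X a ≡ Y a → memAfter p X a ≡ memAfter p Y a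
  memAfter-local (done _)      X Y agree Xa≡Ya = Xa≡Ya
  memAfter-local (read b k)    X Y agree Xa≡Ya rewrite sym (agree (here refl)) =
    memAfter-local (k (X b)) X Y (agree ∘ there) Xa≡Ya
  memAfter-local (write b c k) X Y agree Xa≡Ya =
    memAfter-local k (update {w} X b c) (update {w} Y b c) (agreeOn-update X Y b c agree)
                   (update-cong X Y c (λ _ → Xa≡Ya))

  memAfter-cong : (p : Tree w q) {X Y : Mem w} → (∀ a → X a ≡ Y a) → ∀ a → memAfter p X a ≡ memAfter p Y a
  memAfter-cong p {X} {Y} X≗Y a = memAfter-local p X Y (λ {b} _ → X≗Y b) (X≗Y a)

  result-cong : (p : Tree w q) {X Y : Mem w} → (∀ a → X a ≡ Y a) → result p X ≡ result p Y
  result-cong p {X} {Y} X≗Y = sym (result-local p X Y (λ {b} _ → X≗Y b))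

module _ {n q : ℕ} (U : Fin n → Fin q) where

  uval-< : ∀ {k} (k<n : k < n) → uval U k ≡ toℕ (U (fromℕ< k<n))
  uval-< {k} k<n with k <? n
  ... | yes _   = refl
  ... | no k≮n  = contradiction k<n k≮n

  uval-≥ : ∀ {k} → n ≤ k → uval U k ≡ 0
  uval-≥ {k} n≤k with k <? n
  ... | yes k<n = contradiction k<n (≤⇒≯ n≤k)
  ... | no _    = refl

  uval<q : .{{NonZero q}} → ∀ k → uval U k < q
  uval<q k with k <? n
  ... | yes k<n = toℕ<n (U (fromℕ< k<n))
  ... | no _    = >-nonZero⁻¹ q

module _ {n q : ℕ} {U U' : Fin n → Fin q} where

  uval-injectiveAt : ∀ {k} (k<n : k < n) → uval U k ≡ uval U' k → U (fromℕ< k<n) ≡ U' (fromℕ< k<n)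
  uval-injectiveAt k<n eq = toℕ-injective (trans (sym (uval-< U k<n)) (trans eq (uval-< U' k<n)))

  uval-injective : (∀ k → uval U k ≡ uval U' k) → ∀ i → U i ≡ U' i
  uval-injective agree i =
    subst (λ j → U j ≡ U' j) (fromℕ<-toℕ i (toℕ<n i)) (uval-injectiveAt (toℕ<n i) (agree (toℕ i)))

module Execution {n q w : ℕ} (A : Alg n q w) (U : Fin n → Fin q) where

  open Memory w

  arrival : (t : ℕ) → t < n → Tree w q
  arrival t t<n = step A (fromℕ< t<n) (U (fromℕ< t<n))

  memAt-suc : ∀ t (t<n : t < n) → memAt A U (suc t) ≡ memAfter (arrival t t<n) (memAt A U t)
  memAt-suc t t<n with t <? n
  ... | yes _   = refl
  ... | no t≮n  = contradiction t<n t≮n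

  probesAt-arrival : ∀ t (t<n : t < n) → probesAt A U t ≡ probed (arrival t t<n) (memAt A U t)
  probesAt-arrival t t<n with t <? n
  ... | yes _   = cong (probed (arrival t t<n) ∘ memAt A U) (toℕ-fromℕ< t<n)
  ... | no t≮n  = contradiction t<n t≮n

  outputAt-arrival : ∀ t (t<n : t < n) → outputAt A U (fromℕ< t<n) ≡ result (arrival t t<n) (memAt A U t)
  outputAt-arrival t t<n = cong (result (arrival t t<n) ∘ memAt A U) (toℕ-fromℕ< t<n)

  ∈-probesIn : ∀ T {len r a} → r < len → a ∈ probesAt A U (T + r) → a ∈ probesIn A U T len
  ∈-probesIn T r<len a∈ =
    ∈-concatMap⁺ (λ i → probesAt A U (T + i)) (Any.map (λ { refl → a∈ }) (∈-upTo⁺ r<len))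

  probed-⊆-probesIn : ∀ T {len r} (T+r<n : T + r < n) → r < len → ∀ {a} →
                      a ∈ probed (arrival (T + r) T+r<n) (memAt A U (T + r)) → a ∈ probesIn A U T len
  probed-⊆-probesIn T {r = r} T+r<n r<len =
    ∈-probesIn T r<len ∘ subst (_ ∈_) (sym (probesAt-arrival (T + r) T+r<n))

  memAt-unprobed : ∀ T len {a} → T + len ≤ n → a ∉ probesIn A U T len → memAt A U (T + len) a ≡ memAt A U T a
  memAt-unprobed T len {a} T+len≤n a∉ = go len ≤-refl
    where
      go : ∀ r → r ≤ len → memAt A U (T + r) a ≡ memAt A U T a
      go zero    _        = cong (λ t → memAt A U t a) (+-identityʳ T)
      go (suc r) 1+r≤len rewrite +-suc T r = begin
        memAt A U (suc (T + r)) a                            ≡⟨ cong (λ X → X a) (memAt-suc (T + r) T+r<n) ⟩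
        memAfter (arrival (T + r) T+r<n) (memAt A U (T + r)) a ≡⟨ memAfter-unprobed (arrival (T + r) T+r<n) _
                                                                   (a∉ ∘ probed-⊆-probesIn T T+r<n 1+r≤len) ⟩
        memAt A U (T + r) a                                  ≡⟨ go r (<⇒≤ 1+r≤len) ⟩
        memAt A U T a                                        ∎
        where
          open ≡-Reasoning
          T+r<n : T + r < n
          T+r<n = ≤-trans (+-monoʳ-< T 1+r≤len) T+len≤n

  replay : Mem w → ℕ → ℕ → Mem w
  replay Y T zero    = Y
  replay Y T (suc r) with T + r <? n
  ... | yes T+r<n = memAfter (arrival (T + r) T+r<n) (replay Y T r)
  ... | no _      = replay Y T r

  replay-suc : ∀ Y T r (T+r<n : T + r < n) → replay Y T (suc r) ≡ memAfter (arrival (T + r) T+r<n) (replay Y T r)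
  replay-suc Y T r T+r<n with T + r <? n
  ... | yes _     = refl
  ... | no T+r≮n  = contradiction T+r<n T+r≮n

  replayOutput : Mem w → ∀ T r → T + r < n → Fin q
  replayOutput Y T r T+r<n = result (arrival (T + r) T+r<n) (replay Y T r)

  memAt≡replay : ∀ t → memAt A U t ≡ replay (init A) 0 t
  memAt≡replay zero    = refl
  memAt≡replay (suc t) with t <? n
  ... | yes t<n = cong (memAfter (arrival t t<n)) (memAt≡replay t)
  ... | no _    = memAt≡replay t

  module _ (T len : ℕ) (T+len≤n : T + len ≤ n) (Y : Mem w)
           (Y≈ : AgreeOn (probesIn A U T len) (memAt A U T) Y) where

    replay-simulates : ∀ r → r ≤ len → AgreeOn (probesIn A U T len) (memAt A U (T + r)) (replay Y T r)
    replay-simulates zero    _ rewrite +-identityʳ T = Y≈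
    replay-simulates (suc r) 1+r≤len {a} a∈ = begin
      memAt A U (T + suc r) a                             ≡⟨ cong (λ t → memAt A U t a) (+-suc T r) ⟩
      memAt A U (suc (T + r)) a                           ≡⟨ cong-app (memAt-suc (T + r) T+r<n) a ⟩
      memAfter (arrival (T + r) T+r<n) (memAt A U (T + r)) a
        ≡⟨ memAfter-local (arrival (T + r) T+r<n) _ _ (IH ∘ probed-⊆-probesIn T T+r<n 1+r≤len) (IH a∈) ⟩
      memAfter (arrival (T + r) T+r<n) (replay Y T r) a   ≡⟨ cong-app (replay-suc Y T r T+r<n) a ⟨
      replay Y T (suc r) a                                ∎
      where
        open ≡-Reasoning
        T+r<n : T + r < n
        T+r<n = ≤-trans (+-monoʳ-< T 1+r≤len) T+len≤n
        IH : AgreeOn (probesIn A U T len) (memAt A U (T + r)) (replay Y T r)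
        IH = replay-simulates r (<⇒≤ 1+r≤len)

    outputAt-replay : ∀ r → r < len → (T+r<n : T + r < n) →
                      outputAt A U (fromℕ< T+r<n) ≡ replayOutput Y T r T+r<n
    outputAt-replay r r<len T+r<n = trans (outputAt-arrival (T + r) T+r<n)
      (sym (result-local (arrival (T + r) T+r<n) _ _
             (replay-simulates r (<⇒≤ r<len) ∘ probed-⊆-probesIn T T+r<n r<len)))

module _ {n q w : ℕ} (A : Alg n q w) {U U' : Fin n → Fin q} where
  private
    module E  = Execution A U
    module E' = Execution A U'

  arrival-cong : ∀ {t} (t<n : t < n) → uval U t ≡ uval U' t → E.arrival t t<n ≡ E'.arrival t t<n
  arrival-cong t<n eq = cong (step A (fromℕ< t<n)) (uval-injectiveAt t<n eq)

  replay-cong : ∀ {Y Y'} T r → (∀ k → T ≤ k → k < T + r → uval U k ≡ uval U' k) →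
                (∀ a → Y a ≡ Y' a) → ∀ a → E.replay Y T r a ≡ E'.replay Y' T r a
  replay-cong T zero    _     Y≗Y' = Y≗Y'
  replay-cong T (suc r) agree Y≗Y' a
    with T + r <? n | replay-cong T r (λ k T≤k k<T+r → agree k T≤k (<-trans k<T+r T+r<T+1+r)) Y≗Y'
    where
      T+r<T+1+r : T + r < T + suc r
      T+r<T+1+r = +-monoʳ-< T (n<1+n r)
  ... | yes T+r<n | IH rewrite arrival-cong T+r<n (agree (T + r) (m≤m+n T r) (+-monoʳ-< T (n<1+n r))) =
    memAfter-cong (E'.arrival (T + r) T+r<n) IH a
  ... | no _      | IH = IH a

  replayOutput-cong : ∀ {Y Y'} T r (T+r<n : T + r < n) → (∀ k → T ≤ k → uval U k ≡ uval U' k) →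
                      (∀ a → Y a ≡ Y' a) → E.replayOutput Y T r T+r<n ≡ E'.replayOutput Y' T r T+r<n
  replayOutput-cong T r T+r<n agree Y≗Y' rewrite arrival-cong T+r<n (agree (T + r) (m≤m+n T r)) =
    result-cong (E'.arrival (T + r) T+r<n) (replay-cong T r (λ k T≤k _ → agree k T≤k) Y≗Y')

  memAt-cong : ∀ t → (∀ k → k < t → uval U k ≡ uval U' k) → ∀ a → memAt A U t a ≡ memAt A U' t a
  memAt-cong t agree a rewrite E.memAt≡replay t | E'.memAt≡replay t =
    replay-cong 0 t (λ k _ → agree k) (λ _ → refl) a

-- The information transfer determines the right half of a node

module Transfer {n q w : ℕ} (A : Alg n q w) (t₀ h : ℕ) where

  open Memory w
  open DecMembership (_≟ᶠ_ {n = 2 ^ w}) using (_∈?_)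

  T : ℕ
  T = t₀ + h

  leftProbes rightProbes : (Fin n → Fin q) → List (Word w)
  leftProbes  U = probesIn A U t₀ h
  rightProbes U = probesIn A U T h

  transfer : (Fin n → Fin q) → List (Word w × Word w)
  transfer U = map (λ a → a , memAt A U T a) (shared (leftProbes U) (rightProbes U))

  length-transfer : ∀ U → length (transfer U) ≡ interSize {w} (leftProbes U) (rightProbes U)
  length-transfer U = length-map _ (shared (leftProbes U) (rightProbes U))

  -- A cell probed on the right is either shared, hence recorded by the transfer,
  -- or not probed on the left, hence unchanged since t₀.
  memAt-overlay : T + h ≤ n → ∀ U → AgreeOn (rightProbes U) (memAt A U T) (overlay (memAt A U t₀) (transfer U))
  memAt-overlay T+h≤n U {a} a∈R with a ∈? leftProbes U
  ... | yes a∈L = sym (overlay-∈ (memAt A U t₀) (memAt A U T) (∈-shared a∈L a∈R))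
  ... | no  a∉L = begin
    memAt A U T a     ≡⟨ Execution.memAt-unprobed A U t₀ h (≤-trans (m≤m+n T h) T+h≤n) a∉L ⟩
    memAt A U t₀ a    ≡⟨ overlay-∉ (memAt A U t₀) (memAt A U T) (a∉L ∘ shared-⊆ˡ) ⟨
    overlay (memAt A U t₀) (transfer U) a ∎
    where open ≡-Reasoning

  outputs-determined : T + h ≤ n → ∀ {U U'} →
    (∀ k → k < t₀ → uval U k ≡ uval U' k) → (∀ k → T ≤ k → uval U k ≡ uval U' k) →
    transfer U ≡ transfer U' →
    ∀ r → r < h → (T+r<n : T + r < n) → outputAt A U (fromℕ< T+r<n) ≡ outputAt A U' (fromℕ< T+r<n)
  outputs-determined T+h≤n {U} {U'} agreeL agreeR same-transfer r r<h T+r<n = begin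
    outputAt A U (fromℕ< T+r<n)     ≡⟨ E.outputAt-replay T h T+h≤n (Y U) (memAt-overlay T+h≤n U) r r<h T+r<n ⟩
    E.replayOutput (Y U) T r T+r<n   ≡⟨ replayOutput-cong A T r T+r<n agreeR Y≗Y' ⟩
    E'.replayOutput (Y U') T r T+r<n ≡⟨ E'.outputAt-replay T h T+h≤n (Y U') (memAt-overlay T+h≤n U') r r<h T+r<n ⟨
    outputAt A U' (fromℕ< T+r<n)    ∎
    where
      open ≡-Reasoning
      module E  = Execution A U
      module E' = Execution A U'
      Y : (Fin n → Fin q) → Mem w
      Y U = overlay (memAt A U t₀) (transfer U)
      Y≗Y' : ∀ a → Y U a ≡ Y U' a
      Y≗Y' a = cong₂ (λ x E → fromMaybe x (lookupCell E a)) (memAt-cong A t₀ agreeL a) same-transfer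

-- Recovering the inputs from the outputs

sum-tabulate-swap : ∀ {n} (f g : Fin n → ℕ) (i₀ : Fin n) → (∀ i → i ≢ i₀ → f i ≡ g i) →
                    sum (tabulate f) + g i₀ ≡ sum (tabulate g) + f i₀
sum-tabulate-swap {suc n} f g zero f≗g
  rewrite tabulate-cong {f = f ∘ suc} {g ∘ suc} (λ i → f≗g (suc i) λ ()) = swap (f zero) _ (g zero)
  where
    swap : ∀ a b c → a + b + c ≡ c + b + a
    swap = solve-∀
sum-tabulate-swap {suc n} f g (suc i₀) f≗g = begin
  f zero + sum (tabulate (f ∘ suc)) + g (suc i₀)   ≡⟨ +-assoc (f zero) _ _ ⟩
  f zero + (sum (tabulate (f ∘ suc)) + g (suc i₀)) ≡⟨ cong₂ _+_ (f≗g zero λ ())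
                                                        (sum-tabulate-swap (f ∘ suc) (g ∘ suc) i₀ λ i i≢i₀ →
                                                          f≗g (suc i) (i≢i₀ ∘ Fin.suc-injective)) ⟩
  g zero + (sum (tabulate (g ∘ suc)) + f (suc i₀)) ≡⟨ +-assoc (g zero) _ _ ⟨
  g zero + sum (tabulate (g ∘ suc)) + f (suc i₀)   ∎
  where open ≡-Reasoning

module _ {q : ℕ} .{{_ : NonZero q}} where

  open import Data.Nat.DivMod using () renaming (_/_ to _/ℕ_)

  [m+d]%q≡m%q⇒d≡0 : ∀ m d → d < q → (m + d) % q ≡ m % q → d ≡ 0
  [m+d]%q≡m%q⇒d≡0 m zero      _   _  = refl
  [m+d]%q≡m%q⇒d≡0 m d@(suc _) d<q eq = contradiction q∣d (>⇒∤ d<q)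
    where
      quotients : (m + d) /ℕ q * q ≡ m /ℕ q * q + d
      quotients = +-cancelˡ-≡ (m % q) _ _ (begin
        m % q + (m + d) /ℕ q * q        ≡⟨ cong (_+ (m + d) /ℕ q * q) eq ⟨
        (m + d) % q + (m + d) /ℕ q * q  ≡⟨ m≡m%n+[m/n]*n (m + d) q ⟨
        m + d                          ≡⟨ cong (_+ d) (m≡m%n+[m/n]*n m q) ⟩
        m % q + m /ℕ q * q + d          ≡⟨ +-assoc (m % q) _ d ⟩
        m % q + (m /ℕ q * q + d)        ∎)
        where open ≡-Reasoning
      q∣d : q ∣ d
      q∣d = ∣m+n∣m⇒∣n (subst (q ∣_) quotients (n∣m*n ((m + d) /ℕ q))) (n∣m*n (m /ℕ q))

  private
    cancel-≤ : ∀ {S S' x x'} → x ≤ x' → x' < q → S + x' ≡ S' + x → S % q ≡ S' % q → x ≡ x'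
    cancel-≤ {S} {S'} {x} {x'} x≤x' x'<q eq eq%q = begin
      x           ≡⟨ +-identityʳ x ⟨
      x + 0       ≡⟨ cong (x +_) d≡0 ⟨
      x + d       ≡⟨ m+[n∸m]≡n x≤x' ⟩
      x'          ∎
      where
        open ≡-Reasoning
        d : ℕ
        d = x' ∸ x
        S'≡S+d : S' ≡ S + d
        S'≡S+d = +-cancelʳ-≡ x S' (S + d) (begin
          S' + x        ≡⟨ eq ⟨
          S + x'        ≡⟨ cong (S +_) (m∸n+n≡m x≤x') ⟨
          S + (d + x)   ≡⟨ +-assoc S d x ⟨
          S + d + x     ∎)
        d≡0 : d ≡ 0
        d≡0 = [m+d]%q≡m%q⇒d≡0 S d (≤-<-trans (m∸n≤m x' x) x'<q) (trans (cong (_% q) (sym S'≡S+d)) (sym eq%q))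

  +-%-cancel : ∀ {S S' x x'} → x < q → x' < q → S + x' ≡ S' + x → S % q ≡ S' % q → x ≡ x'
  +-%-cancel {x = x} {x'} x<q x'<q eq eq%q with ≤-total x x'
  ... | inj₁ x≤x' = cancel-≤ x≤x' x'<q eq eq%q
  ... | inj₂ x'≤x = sym (cancel-≤ x'≤x x<q (sym eq) (sym eq%q))

-- Position i of the stream holds the arrival from d steps earlier.
infix 4 _HasLag_
_HasLag_ : ∀ {n} → Fin n → ℕ → Set
_HasLag_ {n} i d = toℕ i + d + 1 ≡ n

module _ {n q : ℕ} {i : Fin n} {d : ℕ} (lag : i HasLag d) where

  private
    position : ∀ {t} → d ≤ t → t + toℕ i + 1 ≡ t ∸ d + n
    position {t} d≤t = begin
      t + toℕ i + 1             ≡⟨ cong (λ t → t + toℕ i + 1) (m∸n+n≡m d≤t) ⟨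
      t ∸ d + d + toℕ i + 1     ≡⟨ rearrange (t ∸ d) d (toℕ i) ⟩
      t ∸ d + (toℕ i + d + 1)   ≡⟨ cong (t ∸ d +_) lag ⟩
      t ∸ d + n                 ∎
      where
        open ≡-Reasoning
        rearrange : ∀ a b c → a + b + c + 1 ≡ a + (c + b + 1)
        rearrange = solve-∀

  streamAt-lag≤ : (U : Fin n → Fin q) {t : ℕ} → d ≤ t → streamAt U t i ≡ uval U (t ∸ d)
  streamAt-lag≤ U {t} d≤t with n ≤? t + toℕ i + 1
  ... | yes _   = cong (uval U) (trans (cong (_∸ n) (position d≤t)) (m+n∸n≡m (t ∸ d) n))
  ... | no n≰   = contradiction (subst (n ≤_) (sym (position d≤t)) (m≤n+m n (t ∸ d))) n≰

  streamAt-lag> : (U : Fin n → Fin q) {t : ℕ} → t < d → streamAt U t i ≡ 0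
  streamAt-lag> U {t} t<d with n ≤? t + toℕ i + 1
  ... | no _    = refl
  ... | yes n≤  = contradiction n≤ (<⇒≱ (subst (t + toℕ i + 1 <_) (trans (cong (_+ 1) (+-comm d (toℕ i))) lag)
                                          (+-monoˡ-< 1 (+-monoˡ-< (toℕ i) t<d))))

  streamAt-cong : {U U' : Fin n → Fin q} {t : ℕ} → (d ≤ t → uval U (t ∸ d) ≡ uval U' (t ∸ d)) →
                  streamAt U t i ≡ streamAt U' t i
  streamAt-cong {U} {U'} {t} agree with d ≤? t
  ... | yes d≤t = trans (streamAt-lag≤ U d≤t) (trans (agree d≤t) (sym (streamAt-lag≤ U' d≤t)))
  ... | no d≰t  = trans (streamAt-lag> U (≰⇒> d≰t)) (sym (streamAt-lag> U' (≰⇒> d≰t)))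

2^-apart : ∀ {a b} → a ≢ b → 2 ^ a < 2 ^ b ⊎ 2 ^ b + 2 ^ b ≤ 2 ^ a
2^-apart {a} {b} a≢b with <-cmp a b
... | tri< a<b _ _ = inj₁ (^-monoʳ-< 2 (s≤s (s≤s z≤n)) a<b)
... | tri≈ _ a≡b _ = contradiction a≡b a≢b
... | tri> _ _ b<a = inj₂ (subst (_≤ 2 ^ a) (cong (2 ^ b +_) (+-identityʳ (2 ^ b))) (^-monoʳ-≤ 2 b<a))

lag-outside : ∀ {t₀ h r d} → d < h ⊎ h + h ≤ d → r < h → d ≤ t₀ + h + r →
              t₀ + h + r ∸ d < t₀ ⊎ t₀ + r < t₀ + h + r ∸ d
lag-outside {t₀} {h} {r} {d} (inj₁ d<h) r<h d≤t = inj₂ (m+n≤o⇒m≤o∸n (suc (t₀ + r)) (begin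
  suc (t₀ + r) + d   ≡⟨ +-suc (t₀ + r) d ⟨
  t₀ + r + suc d     ≤⟨ +-monoʳ-≤ (t₀ + r) d<h ⟩
  t₀ + r + h         ≡⟨ xy∙z≈xz∙y t₀ r h ⟩
  t₀ + h + r         ∎))
  where open ≤-Reasoning
lag-outside {t₀} {h} {r} {d} (inj₂ h+h≤d) r<h d≤t = inj₁ (+-cancelʳ-< d _ t₀ (begin-strict
  t₀ + h + r ∸ d + d ≡⟨ m∸n+n≡m d≤t ⟩
  t₀ + h + r         <⟨ +-monoʳ-< (t₀ + h) r<h ⟩
  t₀ + h + h         ≡⟨ +-assoc t₀ h h ⟩
  t₀ + (h + h)       ≤⟨ +-monoʳ-≤ t₀ h+h≤d ⟩
  t₀ + d             ∎))
  where open ≤-Reasoning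

module Recovery {n q : ℕ} .{{_ : NonZero q}} (F : Fin n → Fin q)
  (F-support : ∀ i → toℕ (F i) ≡ 0 ⊎ Σ ℕ λ e′ → i HasLag 2 ^ e′)
  {e : ℕ} {i₀ : Fin n} (i₀-lag : i₀ HasLag 2 ^ e) (F-i₀ : toℕ (F i₀) ≡ 1) (t₀ : ℕ) where

  h : ℕ
  h = 2 ^ e

  term : (Fin n → Fin q) → ℕ → Fin n → ℕ
  term U t i = toℕ (F i) * streamAt U t i

  convAt-terms : ∀ U t → convAt F U t ≡ sum (tabulate (term U t)) % q
  convAt-terms U t = cong (λ xs → sum xs % q) (map-tabulate id (term U t))

  term-i₀ : ∀ U r → term U (t₀ + h + r) i₀ ≡ uval U (t₀ + r)
  term-i₀ U r rewrite F-i₀ = begin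
    streamAt U (t₀ + h + r) i₀ + 0  ≡⟨ +-identityʳ _ ⟩
    streamAt U (t₀ + h + r) i₀      ≡⟨ streamAt-lag≤ i₀-lag U h≤t ⟩
    uval U (t₀ + h + r ∸ h)         ≡⟨ cong (λ k → uval U (k ∸ h)) (xy∙z≈xz∙y t₀ h r) ⟩
    uval U (t₀ + r + h ∸ h)         ≡⟨ cong (uval U) (m+n∸n≡m (t₀ + r) h) ⟩
    uval U (t₀ + r)                 ∎
    where
      open ≡-Reasoning
      h≤t : h ≤ t₀ + h + r
      h≤t = ≤-trans (m≤n+m h t₀) (m≤m+n (t₀ + h) r)

  -- Every other lag 2^e′ of F reads U outside the unknown window [t₀, t₀ + r].
  term-others : ∀ {U U'} r → r < h → (∀ k → k < t₀ ⊎ t₀ + r < k → uval U k ≡ uval U' k) →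
                ∀ i → i ≢ i₀ → term U (t₀ + h + r) i ≡ term U' (t₀ + h + r) i
  term-others r r<h agree i i≢i₀ with F-support i
  ... | inj₁ Fi≡0         rewrite Fi≡0 = refl
  ... | inj₂ (e′ , lag) = cong (toℕ (F i) *_) (streamAt-cong lag λ d≤t →
          agree _ (lag-outside (2^-apart e′≢e) r<h d≤t))
    where
      e′≢e : e′ ≢ e
      e′≢e refl = i≢i₀ (toℕ-injective (+-cancelʳ-≡ h _ _ (+-cancelʳ-≡ 1 _ _ (trans lag (sym i₀-lag)))))

  recover-at : ∀ {U U'} r → r < h → (∀ k → k < t₀ ⊎ t₀ + r < k → uval U k ≡ uval U' k) →
               convAt F U (t₀ + h + r) ≡ convAt F U' (t₀ + h + r) → uval U (t₀ + r) ≡ uval U' (t₀ + r)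
  recover-at {U} {U'} r r<h agree same-conv = begin
    uval U (t₀ + r)          ≡⟨ term-i₀ U r ⟨
    term U t i₀              ≡⟨ +-%-cancel (subst (_< q) (sym (term-i₀ U r)) (uval<q U _))
                                           (subst (_< q) (sym (term-i₀ U' r)) (uval<q U' _))
                                           (sum-tabulate-swap (term U t) (term U' t) i₀ (term-others r r<h agree))
                                           (trans (sym (convAt-terms U t)) (trans same-conv (convAt-terms U' t))) ⟩
    term U' t i₀             ≡⟨ term-i₀ U' r ⟩
    uval U' (t₀ + r)         ∎
    where
      open ≡-Reasoning
      t : ℕ
      t = t₀ + h + r

  -- Downward induction: the outputs at t₀ + h + r for r = h-1, …, 0 reveal U[t₀ + r] in turn.
  recover : ∀ {U U'} → (∀ k → k < t₀ ⊎ t₀ + h ≤ k → uval U k ≡ uval U' k) →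
            (∀ r → r < h → convAt F U (t₀ + h + r) ≡ convAt F U' (t₀ + h + r)) →
            ∀ k → uval U k ≡ uval U' k
  recover {U} {U'} outside same-conv k = known-from 0 h refl k (before-or-after k)
    where
      before-or-after : ∀ k → k < t₀ ⊎ t₀ + 0 ≤ k
      before-or-after k with k <? t₀
      ... | yes k<t₀ = inj₁ k<t₀
      ... | no k≮t₀  = inj₂ (subst (_≤ k) (sym (+-identityʳ t₀)) (≮⇒≥ k≮t₀))

      known-from : ∀ r d → r + d ≡ h → ∀ k → k < t₀ ⊎ t₀ + r ≤ k → uval U k ≡ uval U' k
      known-above : ∀ r d → r + suc d ≡ h → ∀ k → k < t₀ ⊎ t₀ + r < k → uval U k ≡ uval U' k
      known-above r d r+1+d≡h k = known-from (suc r) d (trans (sym (+-suc r d)) r+1+d≡h) k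
                                    ∘ Sum.map₂ (subst (_≤ k) (sym (+-suc t₀ r)))

      known-from r zero r+0≡h k known =
        outside k (Sum.map₂ (subst (λ x → t₀ + x ≤ k) (trans (sym (+-identityʳ r)) r+0≡h)) known)
      known-from r (suc d) r+1+d≡h k (inj₁ k<t₀) = outside k (inj₁ k<t₀)
      known-from r (suc d) r+1+d≡h k (inj₂ t₀+r≤k) with m≤n⇒m<n∨m≡n t₀+r≤k
      ... | inj₁ t₀+r<k = known-above r d r+1+d≡h k (inj₂ t₀+r<k)
      ... | inj₂ refl   = recover-at r r<h (known-above r d r+1+d≡h) (same-conv r r<h)
        where
          r<h : r < h
          r<h = subst (r <_) r+1+d≡h (m<m+n r (s≤s z≤n))

hasPowerLag? : ∀ m (i : Fin (2 ^ m)) → Dec (Σ (Fin m) λ e → i HasLag 2 ^ toℕ e)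
hasPowerLag? m i = any? λ e → toℕ i + 2 ^ toℕ e + 1 ≟ 2 ^ m

hardF : ∀ {m q} → 2 ≤ q → Fin (2 ^ m) → Fin q
hardF {m} (s≤s (s≤s _)) i with hasPowerLag? m i
... | yes _ = suc zero
... | no _  = zero

hardF-support : ∀ {m q} (2≤q : 2 ≤ q) i → toℕ (hardF {m} 2≤q i) ≡ 0 ⊎ Σ ℕ λ e → i HasLag 2 ^ e
hardF-support {m} (s≤s (s≤s _)) i with hasPowerLag? m i
... | yes (e , lag) = inj₂ (toℕ e , lag)
... | no _          = inj₁ refl

hardF-lag : ∀ {m q e i} (2≤q : 2 ≤ q) → e < m → i HasLag 2 ^ e → toℕ (hardF {m} 2≤q i) ≡ 1
hardF-lag {m} {e = e} {i} (s≤s (s≤s _)) e<m lag with hasPowerLag? m i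
... | yes _     = refl
... | no no-lag = contradiction (fromℕ< e<m , subst (λ x → i HasLag 2 ^ x) (sym (toℕ-fromℕ< e<m)) lag) no-lag

-- Counting

module _ {a} {A : Set a} where

  ∈-─ : ∀ {x y} {ys : List A} (x∈ys : x ∈ ys) → y ∈ ys → y ≢ x → y ∈ ys ─ x∈ys
  ∈-─ (here refl) (here refl) y≢x = contradiction refl y≢x
  ∈-─ (here refl) (there y∈)  _   = y∈
  ∈-─ (there _)   (here refl) _   = here refl
  ∈-─ (there x∈)  (there y∈)  y≢x = there (∈-─ x∈ y∈ y≢x)

  Unique-⊆⇒length≤ : ∀ {xs ys : List A} → Unique xs → xs ⊆ ys → length xs ≤ length ys
  Unique-⊆⇒length≤ {[]}     _               _     = z≤n
  Unique-⊆⇒length≤ {x ∷ xs} {ys} (x∉xs ∷ xs!) xs⊆ys =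
    subst (suc (length xs) ≤_) (sym (length-removeAt′ ys (Any.index x∈ys)))
      (s≤s (Unique-⊆⇒length≤ xs! λ y∈xs →
        ∈-─ x∈ys (xs⊆ys (there y∈xs)) (λ y≡x → All.lookup x∉xs y∈xs (sym y≡x))))
    where
      x∈ys : x ∈ ys
      x∈ys = xs⊆ys (here refl)

map-≡⇒≡-on : ∀ {a b} {A : Set a} {B : Set b} {f g : A → B} {xs : List A} →
             map f xs ≡ map g xs → ∀ {x} → x ∈ xs → f x ≡ g x
map-≡⇒≡-on {xs = _ ∷ _} eq (here refl) = ∷-injectiveˡ eq
map-≡⇒≡-on {xs = _ ∷ _} eq (there x∈)  = map-≡⇒≡-on (∷-injectiveʳ eq) x∈

module _ {a b c} {A : Set a} {B : Set b} {C : Set c} (f : A → B → C) where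

  length-cartesianProductWith : ∀ xs ys → length (cartesianProductWith f xs ys) ≡ length xs * length ys
  length-cartesianProductWith []       ys = refl
  length-cartesianProductWith (x ∷ xs) ys = trans (length-++ (map (f x) ys))
    (cong₂ _+_ (length-map (f x) ys) (length-cartesianProductWith xs ys))

  concatMap-map≡cartesianProductWith : ∀ xs ys → concatMap (λ x → map (f x) ys) xs ≡ cartesianProductWith f xs ys
  concatMap-map≡cartesianProductWith []       ys = refl
  concatMap-map≡cartesianProductWith (x ∷ xs) ys = cong (map (f x) ys ++_) (concatMap-map≡cartesianProductWith xs ys)

allArrays-suc : ∀ n q → allArrays (suc n) q ≡ cartesianProductWith VF._∷_ (allFin q) (allArrays n q)
allArrays-suc n q = concatMap-map≡cartesianProductWith VF._∷_ (allFin q) (allArrays n q)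

length-allArrays : ∀ n q → length (allArrays n q) ≡ q ^ n
length-allArrays zero    q = refl
length-allArrays (suc n) q rewrite allArrays-suc n q =
  trans (length-cartesianProductWith VF._∷_ (allFin q) (allArrays n q))
        (cong₂ _*_ (length-tabulate {n = q} id) (length-allArrays n q))

allArrays-unique : ∀ n q → UniqueSetoid.Unique (Fin n →-setoid Fin q) (allArrays n q)
allArrays-unique zero    q = [] ∷ []
allArrays-unique (suc n) q rewrite allArrays-suc n q =
  UniqueS.cartesianProductWith⁺ (setoid (Fin q)) (Fin n →-setoid Fin q) (Fin (suc n) →-setoid Fin q)
    VF._∷_ (λ eq → eq zero , eq ∘ suc) (allFin⁺ q) (allArrays-unique n q)

module _ {a} {A : Set a} where

  listsOfLength : List A → ℕ → List (List A)
  listsOfLength xs zero    = [] ∷ []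
  listsOfLength xs (suc L) = cartesianProductWith _∷_ xs (listsOfLength xs L)

  length-listsOfLength : ∀ xs L → length (listsOfLength xs L) ≡ length xs ^ L
  length-listsOfLength xs zero    = refl
  length-listsOfLength xs (suc L) =
    trans (length-cartesianProductWith _∷_ xs (listsOfLength xs L)) (cong (length xs *_) (length-listsOfLength xs L))

  ∈-listsOfLength : ∀ {xs ys} → All (_∈ xs) ys → ys ∈ listsOfLength xs (length ys)
  ∈-listsOfLength []           = here refl
  ∈-listsOfLength (y∈ ∷ ys∈) = ∈-cartesianProductWith⁺ _∷_ y∈ (∈-listsOfLength ys∈)

  listsOfLength≤ : List A → ℕ → List (List A)
  listsOfLength≤ xs zero    = [] ∷ []
  listsOfLength≤ xs (suc s) = [] ∷ cartesianProductWith _∷_ xs (listsOfLength≤ xs s)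

  length-listsOfLength≤ : ∀ xs s → length (listsOfLength≤ xs s) ≤ suc (length xs) ^ s
  length-listsOfLength≤ xs zero    = ≤-refl
  length-listsOfLength≤ xs (suc s) = begin
    suc (length (cartesianProductWith _∷_ xs (listsOfLength≤ xs s)))
      ≡⟨ cong suc (length-cartesianProductWith _∷_ xs (listsOfLength≤ xs s)) ⟩
    suc (length xs * length (listsOfLength≤ xs s)) ≤⟨ s≤s (*-monoʳ-≤ (length xs) (length-listsOfLength≤ xs s)) ⟩
    suc (length xs * P)                            ≤⟨ +-monoˡ-≤ (length xs * P) (m^n>0 (suc (length xs)) s) ⟩
    P + length xs * P                              ∎
    where
      open ≤-Reasoning
      P : ℕ
      P = suc (length xs) ^ s

  ∈-listsOfLength≤ : ∀ {xs ys s} → length ys ≤ s → All (_∈ xs) ys → ys ∈ listsOfLength≤ xs s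
  ∈-listsOfLength≤ {s = zero}  z≤n       []           = here refl
  ∈-listsOfLength≤ {s = suc s} _         []           = here refl
  ∈-listsOfLength≤ {s = suc s} (s≤s len≤) (y∈ ∷ ys∈) =
    there (∈-cartesianProductWith⁺ _∷_ y∈ (∈-listsOfLength≤ len≤ ys∈))

  markov : ∀ (f : A → ℕ) s xs →
           suc s * length xs ≤ sum (map f xs) + suc s * length (filter (λ x → f x ≤? s) xs)
  markov f s []       = ≤-refl
  markov f s (x ∷ xs) with f x ≤? s
  ... | yes fx≤s rewrite filter-accept (λ x → f x ≤? s) {x} {xs} fx≤s = begin
    suc s * suc (length xs)                ≡⟨ *-suc (suc s) (length xs) ⟩
    suc s + suc s * length xs              ≤⟨ +-monoʳ-≤ (suc s) (markov f s xs) ⟩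
    suc s + (S + suc s * G)                ≡⟨ rearrange (suc s) S G ⟩
    S + suc s * suc G                      ≤⟨ +-monoˡ-≤ (suc s * suc G) (m≤n+m S (f x)) ⟩
    f x + S + suc s * suc G                ∎
    where
      open ≤-Reasoning
      S G : ℕ
      S = sum (map f xs)
      G = length (filter (λ x → f x ≤? s) xs)
      rearrange : ∀ a b c → a + (b + a * c) ≡ b + a * suc c
      rearrange = solve-∀
  ... | no fx≰s rewrite filter-reject (λ x → f x ≤? s) {x} {xs} fx≰s = begin
    suc s * suc (length xs)                ≡⟨ *-suc (suc s) (length xs) ⟩
    suc s + suc s * length xs              ≤⟨ +-mono-≤ (≰⇒> fx≰s) (markov f s xs) ⟩
    f x + (S + suc s * G)                  ≡⟨ +-assoc (f x) S _ ⟨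
    f x + S + suc s * G                    ∎
    where
      open ≤-Reasoning
      S G : ℕ
      S = sum (map f xs)
      G = length (filter (λ x → f x ≤? s) xs)

  sum-≥-half : ∀ (f : A → ℕ) s xs → 2 * length (filter (λ x → f x ≤? s) xs) ≤ length xs →
               suc s * length xs ≤ 2 * sum (map f xs)
  sum-≥-half f s xs few = +-cancelʳ-≤ (suc s * L) (suc s * L) (2 * S) (begin
    suc s * L + suc s * L     ≡⟨ double (suc s * L) ⟩
    2 * (suc s * L)           ≤⟨ *-monoʳ-≤ 2 (markov f s xs) ⟩
    2 * (S + suc s * G)       ≡⟨ rearrange S (suc s) G ⟩
    2 * S + suc s * (2 * G)   ≤⟨ +-monoʳ-≤ (2 * S) (*-monoʳ-≤ (suc s) few) ⟩
    2 * S + suc s * L         ∎)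
    where
      open ≤-Reasoning
      L S G : ℕ
      L = length xs
      S = sum (map f xs)
      G = length (filter (λ x → f x ≤? s) xs)
      double : ∀ a → a + a ≡ 2 * a
      double = solve-∀
      rearrange : ∀ a b c → 2 * (a + b * c) ≡ 2 * a + b * (2 * c)
      rearrange = solve-∀

2^⌊log2⌋≤ : ∀ n (rec : Acc _<_ n) → 1 ≤ n → 2 ^ ⌊log2⌋ n rec ≤ n
2^⌊log2⌋≤ 1                   _         _ = ≤-refl
2^⌊log2⌋≤ (suc (suc k))       (acc rec) _ = begin
  2 * 2 ^ ⌊log2⌋ (suc ⌊ k /2⌋) _   ≤⟨ *-monoʳ-≤ 2 (2^⌊log2⌋≤ (suc ⌊ k /2⌋) _ (s≤s z≤n)) ⟩
  2 * suc ⌊ k /2⌋                   ≡⟨ *-suc 2 ⌊ k /2⌋ ⟩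
  2 + (⌊ k /2⌋ + (⌊ k /2⌋ + 0))     ≡⟨ cong (λ x → 2 + (⌊ k /2⌋ + x)) (+-identityʳ ⌊ k /2⌋) ⟩
  2 + (⌊ k /2⌋ + ⌊ k /2⌋)           ≤⟨ +-monoʳ-≤ 2 (+-monoʳ-≤ ⌊ k /2⌋ (⌊n/2⌋≤⌈n/2⌉ k)) ⟩
  2 + (⌊ k /2⌋ + ⌈ k /2⌉)           ≡⟨ cong (2 +_) (⌊n/2⌋+⌈n/2⌉≡n k) ⟩
  2 + k                             ∎
  where open ≤-Reasoning

2^⌊log₂⌋≤ : ∀ q → 1 ≤ q → 2 ^ ⌊log₂ q ⌋ ≤ q
2^⌊log₂⌋≤ q = 2^⌊log2⌋≤ q (<-wellFounded q)

module Threshold (w : ℕ) .{{_ : NonZero w}} where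

  open import Data.Nat.DivMod using () renaming (_/_ to _/ℕ_)

  private instance
    4w≢0 : NonZero (4 * w)
    4w≢0 = m*n≢0 4 w

  private
    2+w+w≤4w : 2 + (w + w) ≤ 4 * w
    2+w+w≤4w = begin
      2 + (w + w)         ≤⟨ +-monoˡ-≤ (w + w) (+-mono-≤ (>-nonZero⁻¹ w) (>-nonZero⁻¹ w)) ⟩
      w + w + (w + w)     ≡⟨ four w ⟩
      4 * w               ∎
      where
        open ≤-Reasoning
        four : ∀ w → w + w + (w + w) ≡ 4 * w
        four = solve-∀

  threshold : ℕ → ℕ
  threshold x = x /ℕ (4 * w)

  exponent≤ : ∀ {x} → 1 ≤ x → suc (suc (w + w) * (threshold x)) ≤ x
  exponent≤ {x} 1≤x with threshold x in eq
  ... | zero  = subst (λ y → suc y ≤ x) (sym (*-zeroʳ (suc (w + w)))) 1≤x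
  ... | suc s = begin
    suc (suc (w + w) * suc s)        ≤⟨ +-monoˡ-≤ (suc (w + w) * suc s) (s≤s (z≤n {s})) ⟩
    suc s + suc (w + w) * suc s      ≡⟨ collect (suc s) (w + w) ⟩
    (2 + (w + w)) * suc s            ≤⟨ *-monoˡ-≤ (suc s) 2+w+w≤4w ⟩
    4 * w * suc s                    ≡⟨ *-comm (4 * w) (suc s) ⟩
    suc s * (4 * w)                  ≡⟨ cong (_* (4 * w)) eq ⟨
    threshold x * (4 * w)            ≤⟨ m/n*n≤m x (4 * w) ⟩
    x                                ∎
    where
      open ≤-Reasoning
      collect : ∀ a b → a + suc b * a ≡ (2 + b) * a
      collect = solve-∀

  -- Each transferred cell is an (address, content) pair of 2w bits.
  transfers≤ : ∀ {x} → 1 ≤ x → 2 * suc (2 ^ w * 2 ^ w) ^ (threshold x) ≤ 2 ^ x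
  transfers≤ {x} 1≤x = begin
    2 * suc K ^ s                 ≤⟨ *-monoʳ-≤ 2 (^-monoˡ-≤ s 1+K≤) ⟩
    2 * (2 ^ suc (w + w)) ^ s     ≡⟨ cong (2 *_) (^-*-assoc 2 (suc (w + w)) s) ⟩
    2 ^ suc (suc (w + w) * s)     ≤⟨ ^-monoʳ-≤ 2 (exponent≤ 1≤x) ⟩
    2 ^ x                         ∎
    where
      open ≤-Reasoning
      K s : ℕ
      K = 2 ^ w * 2 ^ w
      s = threshold x
      1+K≤ : suc K ≤ 2 ^ suc (w + w)
      1+K≤ = begin
        suc K           ≤⟨ +-monoˡ-≤ K (*-mono-≤ (m^n>0 2 w) (m^n>0 2 w)) ⟩
        K + K           ≡⟨ cong (K +_) (+-identityʳ K) ⟨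
        2 * K           ≡⟨ cong (2 *_) (^-distribˡ-+-* 2 w w) ⟨
        2 ^ suc (w + w) ∎

  <[1+threshold]*4w : ∀ x → x < suc (threshold x) * (4 * w)
  <[1+threshold]*4w x = begin-strict
    x                             ≡⟨ m≡m%n+[m/n]*n x (4 * w) ⟩
    x % (4 * w) + threshold x * (4 * w) <⟨ +-monoˡ-< _ (m%n<n x (4 * w)) ⟩
    suc (threshold x) * (4 * w)   ∎
    where open ≤-Reasoning

  2x*Q≤16*S*w : ∀ {x Q S} → suc (threshold x) * Q ≤ 2 * S → 2 * x * Q ≤ 16 * (S * w)
  2x*Q≤16*S*w {x} {Q} {S} few = begin
    2 * x * Q                     ≤⟨ *-monoˡ-≤ Q (*-monoʳ-≤ 2 (<⇒≤ (<[1+threshold]*4w x))) ⟩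
    2 * (suc s * (4 * w)) * Q     ≡⟨ regroup (suc s) w Q ⟩
    4 * w * (2 * (suc s * Q))     ≤⟨ *-monoʳ-≤ (4 * w) (*-monoʳ-≤ 2 few) ⟩
    4 * w * (2 * (2 * S))         ≡⟨ sixteen w S ⟩
    16 * (S * w)                  ∎
    where
      open ≤-Reasoning
      s : ℕ
      s = threshold x
      regroup : ∀ a w Q → 2 * (a * (4 * w)) * Q ≡ 4 * w * (2 * (a * Q))
      regroup = solve-∀
      sixteen : ∀ w S → 4 * w * (2 * (2 * S)) ≡ 16 * (S * w)
      sixteen = solve-∀

node-fits : ∀ {m e j} → suc e ≤ m → j < 2 ^ (m ∸ suc e) → j * 2 ^ suc e + 2 ^ e + 2 ^ e ≤ 2 ^ m
node-fits {m} {e} {j} 1+e≤m j< = begin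
  j * 2 ^ suc e + 2 ^ e + 2 ^ e     ≡⟨ +-assoc (j * 2 ^ suc e) (2 ^ e) (2 ^ e) ⟩
  j * 2 ^ suc e + (2 ^ e + 2 ^ e)   ≡⟨ cong (λ x → j * 2 ^ suc e + (2 ^ e + x)) (+-identityʳ (2 ^ e)) ⟨
  j * 2 ^ suc e + 2 ^ suc e         ≡⟨ +-comm (j * 2 ^ suc e) (2 ^ suc e) ⟩
  suc j * 2 ^ suc e                 ≤⟨ *-monoˡ-≤ (2 ^ suc e) j< ⟩
  2 ^ (m ∸ suc e) * 2 ^ suc e       ≡⟨ ^-distribˡ-+-* 2 (m ∸ suc e) (suc e) ⟨
  2 ^ (m ∸ suc e + suc e)           ≡⟨ cong (2 ^_) (m∸n+n≡m 1+e≤m) ⟩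
  2 ^ m                             ∎
  where open ≤-Reasoning

module LowerBound {m q w : ℕ} .{{_ : NonZero q}} (2≤q : 2 ≤ q) (1≤w : 1 ≤ w)
  (A : Alg (2 ^ m) q w) (solves : Solves (hardF {m} 2≤q) A)
  {e j : ℕ} (1+e≤m : suc e ≤ m) (j< : j < 2 ^ (m ∸ suc e)) where

  private
    F : Fin (2 ^ m) → Fin q
    F = hardF {m} 2≤q

    n h t₀ : ℕ
    n  = 2 ^ m
    h  = 2 ^ e
    t₀ = j * 2 ^ suc e

    h<n : h < n
    h<n = ^-monoʳ-< 2 (s≤s (s≤s z≤n)) 1+e≤m

    i₀ : Fin n
    i₀ = fromℕ< (∸-monoʳ-< (s≤s z≤n) h<n)

    i₀-lag : i₀ HasLag h
    i₀-lag = begin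
      toℕ i₀ + h + 1       ≡⟨ cong (λ i → i + h + 1) (toℕ-fromℕ< _) ⟩
      n ∸ suc h + h + 1    ≡⟨ +-assoc (n ∸ suc h) h 1 ⟩
      n ∸ suc h + (h + 1)  ≡⟨ cong (n ∸ suc h +_) (+-comm h 1) ⟩
      n ∸ suc h + suc h    ≡⟨ m∸n+n≡m h<n ⟩
      n                    ∎
      where open ≡-Reasoning

  open Transfer A t₀ h
  open Recovery F (hardF-support {m} 2≤q) {e} i₀-lag (hardF-lag {m} 2≤q 1+e≤m i₀-lag) t₀ using (recover)

  private
    fits : T + h ≤ n
    fits = node-fits 1+e≤m j<

  outside : List ℕ
  outside = upTo t₀ ++ applyUpTo (T +_) (n ∸ T)

  length-outside : length outside + h ≡ n
  length-outside = begin
    length (upTo t₀ ++ applyUpTo (T +_) (n ∸ T)) + h ≡⟨ cong (_+ h) (length-++ (upTo t₀)) ⟩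
    length (upTo t₀) + length (applyUpTo (T +_) (n ∸ T)) + h
      ≡⟨ cong₂ (λ a b → a + b + h) (length-upTo t₀) (length-applyUpTo (T +_) (n ∸ T)) ⟩
    t₀ + (n ∸ T) + h                                 ≡⟨ xy∙z≈y∙xz t₀ (n ∸ T) h ⟩
    n ∸ T + T                                        ≡⟨ m∸n+n≡m (≤-trans (m≤m+n T h) fits) ⟩
    n                                                ∎
    where open ≡-Reasoning

  Code : Set
  Code = List ℕ × List (Word w × Word w)

  code : (Fin n → Fin q) → Code
  code U = map (uval U) outside , transfer U

  agree-outside : ∀ {U U' : Fin n → Fin q} → map (uval U) outside ≡ map (uval U') outside →
                  ∀ k → k < t₀ ⊎ T ≤ k → uval U k ≡ uval U' k
  agree-outside same k (inj₁ k<t₀) = map-≡⇒≡-on same (∈-++⁺ˡ (∈-upTo⁺ k<t₀))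
  agree-outside {U} {U'} same k (inj₂ T≤k) with n ≤? k
  ... | yes n≤k = trans (uval-≥ U n≤k) (sym (uval-≥ U' n≤k))
  ... | no n≰k  = map-≡⇒≡-on same (∈-++⁺ʳ (upTo t₀) (subst (_∈ applyUpTo (T +_) (n ∸ T)) (m+[n∸m]≡n T≤k)
                    (∈-applyUpTo⁺ (T +_) (∸-monoˡ-< (≰⇒> n≰k) T≤k))))

  convAt-cong-outputAt : ∀ {U U' : Fin n → Fin q} {t} (t<n : t < n) → outputAt A U (fromℕ< t<n) ≡ outputAt A U' (fromℕ< t<n) →
                         convAt F U t ≡ convAt F U' t
  convAt-cong-outputAt {U} {U'} {t} t<n same = begin
    convAt F U t                        ≡⟨ cong (convAt F U) (toℕ-fromℕ< t<n) ⟨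
    convAt F U (toℕ (fromℕ< t<n))       ≡⟨ solves U (fromℕ< t<n) ⟨
    toℕ (outputAt A U (fromℕ< t<n))     ≡⟨ cong toℕ same ⟩
    toℕ (outputAt A U' (fromℕ< t<n))    ≡⟨ solves U' (fromℕ< t<n) ⟩
    convAt F U' (toℕ (fromℕ< t<n))      ≡⟨ cong (convAt F U') (toℕ-fromℕ< t<n) ⟩
    convAt F U' t                       ∎
    where open ≡-Reasoning

  code-injective : ∀ {U U'} → code U ≡ code U' → ∀ i → U i ≡ U' i
  code-injective {U} {U'} same = uval-injective (recover (agree-outside same-outside) same-conv)
    where
      same-outside : map (uval U) outside ≡ map (uval U') outside
      same-outside = cong proj₁ same
      same-conv : ∀ r → r < h → convAt F U (T + r) ≡ convAt F U' (T + r)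
      same-conv r r<h = convAt-cong-outputAt T+r<n (outputs-determined fits (λ k → agree-outside same-outside k ∘ inj₁)
                          (λ k → agree-outside same-outside k ∘ inj₂) (cong proj₂ same) r r<h T+r<n)
        where
          T+r<n : T + r < n
          T+r<n = ≤-trans (+-monoʳ-< T r<h) fits

  cells : List (Word w × Word w)
  cells = cartesianProduct (allFin (2 ^ w)) (allFin (2 ^ w))

  codes : ℕ → List Code
  codes s = cartesianProduct (listsOfLength (upTo q) (length outside)) (listsOfLength≤ cells s)

  code-∈-codes : ∀ {s} U → infoTransfer A U e j ≤ s → code U ∈ codes s
  code-∈-codes {s} U I≤s = ∈-cartesianProduct⁺
    (subst (λ L → map (uval U) outside ∈ listsOfLength (upTo q) L) (length-map (uval U) outside)
      (∈-listsOfLength (All.map⁺ (All.universal (λ k → ∈-upTo⁺ (uval<q U k)) outside))))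
    (∈-listsOfLength≤ (≤-trans (≤-reflexive (length-transfer U)) I≤s)
      (All.universal (λ (a , b) → ∈-cartesianProduct⁺ (∈-allFin a) (∈-allFin b)) (transfer U)))

  length-codes : ∀ s → length (codes s) ≤ q ^ length outside * suc (2 ^ w * 2 ^ w) ^ s
  length-codes s = begin
    length (codes s)                                  ≡⟨ length-cartesianProductWith _,_ (listsOfLength (upTo q) L) (listsOfLength≤ cells s) ⟩
    length (listsOfLength (upTo q) L) * length (listsOfLength≤ cells s)
      ≡⟨ cong (_* length (listsOfLength≤ cells s)) (trans (length-listsOfLength (upTo q) L) (cong (_^ L) (length-upTo q))) ⟩
    q ^ L * length (listsOfLength≤ cells s)          ≤⟨ *-monoʳ-≤ (q ^ L) (length-listsOfLength≤ cells s) ⟩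
    q ^ L * suc (length cells) ^ s                   ≡⟨ cong (λ c → q ^ L * suc c ^ s) length-cells ⟩
    q ^ L * suc (2 ^ w * 2 ^ w) ^ s                  ∎
    where
      open ≤-Reasoning
      L : ℕ
      L = length outside
      length-cells : length cells ≡ 2 ^ w * 2 ^ w
      length-cells = trans (length-cartesianProductWith _,_ (allFin (2 ^ w)) (allFin (2 ^ w)))
                           (cong₂ _*_ (length-tabulate {n = 2 ^ w} id) (length-tabulate {n = 2 ^ w} id))

  lowTransfer : ℕ → List (Fin n → Fin q)
  lowTransfer s = filter (λ U → infoTransfer A U e j ≤? s) (allArrays n q)

  length-lowTransfer : ∀ s → length (lowTransfer s) ≤ q ^ length outside * suc (2 ^ w * 2 ^ w) ^ s
  length-lowTransfer s = begin
    length (lowTransfer s)            ≡⟨ length-map code (lowTransfer s) ⟨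
    length (map code (lowTransfer s)) ≤⟨ Unique-⊆⇒length≤ distinct-codes codes-⊆ ⟩
    length (codes s)                  ≤⟨ length-codes s ⟩
    q ^ length outside * suc (2 ^ w * 2 ^ w) ^ s ∎
    where
      open ≤-Reasoning
      distinct-codes : Unique (map code (lowTransfer s))
      distinct-codes = UniqueS.map⁺ (Fin n →-setoid Fin q) (setoid Code) code-injective
        (UniqueS.filter⁺ (Fin n →-setoid Fin q) (λ U → infoTransfer A U e j ≤? s) (allArrays-unique n q))
      codes-⊆ : map code (lowTransfer s) ⊆ codes s
      codes-⊆ c∈ with ∈-map⁻ code c∈
      ... | U , U∈ , refl = code-∈-codes U (proj₂ (∈-filter⁻ (λ U → infoTransfer A U e j ≤? s) {xs = allArrays n q} U∈))

  private instance
    w≢0 : NonZero w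
    w≢0 = >-nonZero 1≤w

  open Threshold w

  δ : ℕ
  δ = ⌊log₂ q ⌋

  few-lowTransfer : 2 * length (lowTransfer (threshold (δ * h))) ≤ length (allArrays n q)
  few-lowTransfer = begin
    2 * length (lowTransfer s)    ≤⟨ *-monoʳ-≤ 2 (length-lowTransfer s) ⟩
    2 * (q ^ L * suc K ^ s)       ≡⟨ swap (q ^ L) (suc K ^ s) ⟩
    q ^ L * (2 * suc K ^ s)       ≤⟨ *-monoʳ-≤ (q ^ L) (transfers≤ (*-mono-≤ (⌊log₂⌋-mono-≤ 2≤q) (m^n>0 2 e))) ⟩
    q ^ L * 2 ^ (δ * h)           ≡⟨ cong (q ^ L *_) (^-*-assoc 2 δ h) ⟨
    q ^ L * (2 ^ δ) ^ h           ≤⟨ *-monoʳ-≤ (q ^ L) (^-monoˡ-≤ h (2^⌊log₂⌋≤ q (≤-trans (s≤s z≤n) 2≤q))) ⟩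
    q ^ L * q ^ h                 ≡⟨ ^-distribˡ-+-* q L h ⟨
    q ^ (L + h)                   ≡⟨ cong (q ^_) length-outside ⟩
    q ^ n                         ≡⟨ length-allArrays n q ⟨
    length (allArrays n q)        ∎
    where
      open ≤-Reasoning
      s L K : ℕ
      s = threshold (δ * h)
      L = length outside
      K = 2 ^ w * 2 ^ w
      swap : ∀ a b → 2 * (a * b) ≡ a * (2 * b)
      swap = solve-∀

  sum-infoTransfer-≥ : suc (threshold (δ * h)) * q ^ n ≤ 2 * sumInfoTransfer A e j
  sum-infoTransfer-≥ = subst (λ N → suc (threshold (δ * h)) * N ≤ 2 * sumInfoTransfer A e j) (length-allArrays n q)
    (sum-≥-half (λ U → infoTransfer A U e j) (threshold (δ * h)) (allArrays n q) few-lowTransfer)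

  bound : δ * 2 ^ suc e * q ^ n ≤ 16 * (sumInfoTransfer A e j * w)
  bound = begin
    δ * 2 ^ suc e * q ^ n             ≡⟨ regroup δ h (q ^ n) ⟩
    2 * (δ * h) * q ^ n               ≤⟨ 2x*Q≤16*S*w {S = sumInfoTransfer A e j} sum-infoTransfer-≥ ⟩
    16 * (sumInfoTransfer A e j * w)  ∎
    where
      open ≤-Reasoning
      regroup : ∀ a b c → a * (2 * b) * c ≡ 2 * (a * b) * c
      regroup = solve-∀

-- Imported only here: ℤ's prefix +_ would make sections (a +_) of ℕ's _+_ ambiguous above.
open import Data.Integer using (+_; +≤+; +<+)
import Data.Integer as ℤ
import Data.Integer.Properties as ℤ
open import Data.Integer.GCD using (gcd-zeroʳ)
open import Data.Rational using (ℚ; 0ℚ; mkℚ; _/_; ↥_; ↧_; *<*) renaming (_*_ to _*ℚ_; _≤_ to _≤ℚ_; _<_ to _<ℚ_)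
open import Data.Rational.Properties using (↥-/; ↧-/; toℚᵘ-cancel-≤; toℚᵘ-homo-*)
import Data.Rational.Unnormalised as ℚᵘ
import Data.Rational.Unnormalised.Properties as ℚᵘ

0<1/16 : 0ℚ <ℚ + 1 / 16
0<1/16 = *<* (+<+ (s≤s z≤n))

private
  -- gcd-zeroʳ : gcd i 1 ≡ 1, so + n / 1 is already in lowest terms.
  ↥[n/1] : ∀ n → ↥ (+ n / 1) ≡ + n
  ↥[n/1] n = trans (sym (ℤ.*-identityʳ _)) (trans (cong (↥ (+ n / 1) ℤ.*_) (sym (gcd-zeroʳ (+ n)))) (↥-/ (+ n) 1))

  ↧[n/1] : ∀ n → ↧ (+ n / 1) ≡ + 1
  ↧[n/1] n = trans (sym (ℤ.*-identityʳ _)) (trans (cong (↧ (+ n / 1) ℤ.*_) (sym (gcd-zeroʳ (+ n)))) (↧-/ (+ n) 1))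

  scaled-≤ : ∀ (p r : ℚ) {m n} → ↥ p ≡ + m → ↧ p ≡ + 1 → ↥ r ≡ + n → ↧ r ≡ + 1 →
             m ≤ 16 * n → (+ 1 / 16) *ℚ p ≤ℚ r
  scaled-≤ p@(mkℚ (+ m) 0 _) (mkℚ (+ n) 0 _) refl refl refl refl m≤16n =
    toℚᵘ-cancel-≤ (ℚᵘ.≤-respˡ-≃ (ℚᵘ.≃-sym (toℚᵘ-homo-* (+ 1 / 16) p)) (ℚᵘ.*≤* (subst₂ ℤ._≤_
      (sym (trans (ℤ.*-identityʳ _) (ℤ.*-identityˡ (+ m)))) (trans (cong +_ (*-comm 16 n)) (ℤ.pos-* n 16)) (+≤+ m≤16n))))

1/16*-≤ : ∀ m n → m ≤ 16 * n → (+ 1 / 16) *ℚ (+ m / 1) ≤ℚ (+ n / 1)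
1/16*-≤ m n = scaled-≤ (+ m / 1) (+ n / 1) (↥[n/1] m) (↧[n/1] m) (↥[n/1] n) (↧[n/1] n)

lemma8 : Σ ℚ λ k → (0ℚ <ℚ k) ×
           (∀ (m q w : ℕ) → {{_ : NonZero q}} → 2 ≤ q → 1 ≤ w →
            Σ (Fin (2 ^ m) → Fin q) λ F →
            ∀ (A : Alg (2 ^ m) q w) → Solves F A →
            ∀ (e j : ℕ) → suc e ≤ m → j < 2 ^ (m ∸ suc e) →
            k *ℚ ((+ (⌊log₂ q ⌋ * 2 ^ suc e * q ^ (2 ^ m))) / 1)
              ≤ℚ ((+ (sumInfoTransfer A e j * w)) / 1))
lemma8 = + 1 / 16 , 0<1/16 , λ m q w 2≤q 1≤w →
  hardF {m} 2≤q , λ A solves e j 1+e≤m j< →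
    1/16*-≤ (⌊log₂ q ⌋ * 2 ^ suc e * q ^ (2 ^ m)) (sumInfoTransfer A e j * w)
            (LowerBound.bound 2≤q 1≤w A solves 1+e≤m j<)
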